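{- Let $D$ be an orientation of $K_{m,n}$ with bipartition $(V_1,V_2)$, $|V_1|=m$, $|V_2|=n$, and let $G=C_{1,2}(D)$. Then every vertex of $D$ has outdegree at least two in $D$ if and only if the edges of $G$ not belonging to $G[V_1]\cup G[V_2]$ form a complete bipartite graph $K_{m,n}$ with bipartition $(V_1,V_2)$, i.e., every vertex of $V_1$ is adjacent in $G$ to every vertex of $V_2$.
   Context: For vertices $x,y$ of a digraph $H$, $d_H(x,y)$ is the length of a shortest directed $(x,y)$-path. The $(1,2)$-step competition graph $C_{1,2}(D)$ is the simple graph on $V(D)$ in which distinct $u,v$ are adjacent iff there is $w\neq u,v$ with either $d_{D-v}(u,w)\le 1$ and $d_{D-u}(v,w)\le 2$, or $d_{D-u}(v,w)\le 1$ and $d_{D-v}(u,w)\le 2$. $G[V_i]$ denotes the subgraph of $G$ induced by $V_i$. -}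

module Defs where

open import Data.Nat using (ℕ)
open import Data.Fin using (Fin)
open import Data.Bool using (Bool; true; false; not)
open import Data.Sum using (_⊎_; inj₁; inj₂)
open import Data.Product using (_×_; ∃-syntax)
open import Data.List using (List; map; _++_; allFin; length; filterᵇ)
open import Relation.Binary.PropositionalEquality using (_≡_; _≢_)

-- Vertices of K_{m,n}: inj₁ i ∈ V₁ (|V₁| = m), inj₂ j ∈ V₂ (|V₂| = n).
Vtx : ℕ → ℕ → Set
Vtx m n = Fin m ⊎ Fin n

-- An orientation of K_{m,n}: for each edge {i,j} (i ∈ V₁, j ∈ V₂),
-- o i j = true means the arc i → j, o i j = false means the arc j → i.
Orientation : ℕ → ℕ → Set
Orientation m n = Fin m → Fin n → Bool

arcᵇ : ∀ {m n} → Orientation m n → Vtx m n → Vtx m n → Bool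
arcᵇ o (inj₁ i) (inj₂ j) = o i j
arcᵇ o (inj₂ j) (inj₁ i) = not (o i j)
arcᵇ o (inj₁ _) (inj₁ _) = false
arcᵇ o (inj₂ _) (inj₂ _) = false

Arc : ∀ {m n} → Orientation m n → Vtx m n → Vtx m n → Set
Arc o x y = arcᵇ o x y ≡ true

vertices : (m n : ℕ) → List (Vtx m n)
vertices m n = map inj₁ (allFin m) ++ map inj₂ (allFin n)

outdeg : ∀ {m n} → Orientation m n → Vtx m n → ℕ
outdeg {m} {n} o x = length (filterᵇ (arcᵇ o x) (vertices m n))

-- d_{D - x}(a , b) ≤ 1   (a, b vertices of D - x)
Dist≤1 : ∀ {m n} → Orientation m n → (x a b : Vtx m n) → Set
Dist≤1 o x a b = a ≢ x × b ≢ x × (a ≡ b ⊎ Arc o a b)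

-- d_{D - x}(a , b) ≤ 2   (directed paths of length 0, 1 or 2 avoiding x)
Dist≤2 : ∀ {m n} → Orientation m n → (x a b : Vtx m n) → Set
Dist≤2 o x a b =
  a ≢ x × b ≢ x ×
  (a ≡ b ⊎ Arc o a b ⊎ (∃[ z ] (z ≢ x × Arc o a z × Arc o z b)))

C12Adj : ∀ {m n} → Orientation m n → Vtx m n → Vtx m n → Set
C12Adj o u v =
  u ≢ v ×
  (∃[ w ] (w ≢ u × w ≢ v ×
     ((Dist≤1 o v u w × Dist≤2 o u v w) ⊎ (Dist≤1 o u v w × Dist≤2 o v u w))))

-- A vertex u adjacent to v in C₁,₂(D) has an out-neighbour other than v: the
-- path from u to the common prey avoids v and has length one or two.  Conversely,
-- if i ∈ V₁ and j ∈ V₂ have out-neighbours j′ ≠ j and i′ ≠ i, the arc between i′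
-- and j′ makes one of them a common prey of i and j.  Finally, outdegree at least
-- two means every vertex has an out-neighbour avoiding any prescribed vertex, and
-- in a bipartite digraph it suffices to prescribe vertices of the opposite side.

module Submission where

open import Defs
open import Data.Nat using (ℕ; _≤_; z≤n; s≤s)
open import Data.Fin using (Fin; fromℕ<)
import Data.Fin.Properties as Fin
open import Data.Bool using (true; false)
open import Data.Bool.Properties using (T?; T-≡)
open import Data.Empty using (⊥; ⊥-elim)
open import Data.Product using (_×_; _,_; proj₂; ∃-syntax)
open import Data.Sum using (inj₁; inj₂)
open import Data.Sum.Properties using (inj₁-injective; inj₂-injective; ≡-dec)
open import Data.List using (List; []; _∷_; map; _++_; allFin; length; filterᵇ)
open import Data.List.Membership.Propositional using (_∈_)
open import Data.List.Membership.Propositional.Properties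
  using (∈-map⁺; ∈-map⁻; ∈-++⁺ˡ; ∈-++⁺ʳ; ∈-filter⁺; ∈-filter⁻; ∈-allFin)
open import Data.List.Relation.Unary.Any using (here; there)
open import Data.List.Relation.Unary.All using (_∷_)
open import Data.List.Relation.Unary.AllPairs using (_∷_)
open import Data.List.Relation.Unary.Unique.Propositional using (Unique)
import Data.List.Relation.Unary.Unique.Propositional.Properties as Unique
open import Function using (_∘_)
open import Function.Bundles using (_⇔_; mk⇔; Equivalence)
open import Relation.Binary.Definitions using (DecidableEquality)
open import Relation.Binary.PropositionalEquality using (_≡_; _≢_; refl; sym)
open import Relation.Nullary using (yes; no)

module _ {A : Set} where

  ∈∧∈∧≢⇒2≤length : ∀ {xs : List A} {x y} → x ∈ xs → y ∈ xs → x ≢ y → 2 ≤ length xs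
  ∈∧∈∧≢⇒2≤length {_ ∷ _ ∷ _} _          _          _   = s≤s (s≤s z≤n)
  ∈∧∈∧≢⇒2≤length {_ ∷ []}    (here refl) (here refl) x≢y = ⊥-elim (x≢y refl)

  unique∧2≤length⇒∃≢ : DecidableEquality A → ∀ {xs : List A} → Unique xs →
                        2 ≤ length xs → ∀ y → ∃[ x ] (x ∈ xs × x ≢ y)
  unique∧2≤length⇒∃≢ _   {_ ∷ []} _ (s≤s ())
  unique∧2≤length⇒∃≢ _≟_ {x ∷ x′ ∷ _} ((x≢x′ ∷ _) ∷ _) _ y with x ≟ y
  ... | yes refl = x′ , there (here refl) , x≢x′ ∘ sym
  ... | no x≢y   = x , here refl , x≢y

module _ {m n : ℕ} where

  ∈-vertices : (v : Vtx m n) → v ∈ vertices m n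
  ∈-vertices (inj₁ i) = ∈-++⁺ˡ (∈-map⁺ inj₁ (∈-allFin i))
  ∈-vertices (inj₂ j) = ∈-++⁺ʳ (map inj₁ (allFin m)) (∈-map⁺ inj₂ (∈-allFin j))

  vertices-unique : Unique (vertices m n)
  vertices-unique = Unique.++⁺ (Unique.map⁺ inj₁-injective (Unique.allFin⁺ m))
                               (Unique.map⁺ inj₂-injective (Unique.allFin⁺ n))
                               sides-disjoint
    where
    sides-disjoint : ∀ {v} → v ∈ map inj₁ (allFin m) × v ∈ map inj₂ (allFin n) → ⊥
    sides-disjoint (v∈V₁ , v∈V₂) with ∈-map⁻ inj₁ v∈V₁ | ∈-map⁻ inj₂ v∈V₂
    ... | _ , _ , refl | _ , _ , ()

  OutNeighbours : Orientation m n → Vtx m n → List (Vtx m n)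
  OutNeighbours o x = filterᵇ (arcᵇ o x) (vertices m n)

  ∈-OutNeighbours⇔Arc : ∀ o x z → z ∈ OutNeighbours o x ⇔ Arc o x z
  ∈-OutNeighbours⇔Arc o x z = mk⇔
    (Equivalence.to T-≡ ∘ proj₂ ∘ ∈-filter⁻ (T? ∘ arcᵇ o x) {xs = vertices m n})
    (∈-filter⁺ (T? ∘ arcᵇ o x) (∈-vertices z) ∘ Equivalence.from T-≡)

  2≤outdeg⇒∃Arc≢ : ∀ o x → 2 ≤ outdeg o x → ∀ y → ∃[ z ] (z ≢ y × Arc o x z)
  2≤outdeg⇒∃Arc≢ o x 2≤d y
    with unique∧2≤length⇒∃≢ (≡-dec Fin._≟_ Fin._≟_)
           (Unique.filter⁺ (T? ∘ arcᵇ o x) vertices-unique) 2≤d y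
  ... | z , z∈N , z≢y = z , z≢y , Equivalence.to (∈-OutNeighbours⇔Arc o x z) z∈N

  Arc∧Arc∧≢⇒2≤outdeg : ∀ o x {z z′} → z ≢ z′ → Arc o x z → Arc o x z′ → 2 ≤ outdeg o x
  Arc∧Arc∧≢⇒2≤outdeg o x z≢z′ xz xz′ =
    ∈∧∈∧≢⇒2≤length (Equivalence.from (∈-OutNeighbours⇔Arc o x _) xz)
                   (Equivalence.from (∈-OutNeighbours⇔Arc o x _) xz′) z≢z′

  no-unique-out-neighbour⇒2≤outdeg : ∀ o x {z} → Arc o x z →
    (∀ {z} → Arc o x z → ∃[ z′ ] (z′ ≢ z × Arc o x z′)) → 2 ≤ outdeg o x
  no-unique-out-neighbour⇒2≤outdeg o x xz another with another xz
  ... | z′ , z′≢z , xz′ = Arc∧Arc∧≢⇒2≤outdeg o x z′≢z xz′ xz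

module _ {m n : ℕ} {o : Orientation m n} {u v : Vtx m n} where

  C12Adj-sym : C12Adj o u v → C12Adj o v u
  C12Adj-sym (u≢v , w , w≢u , w≢v , inj₁ p) = u≢v ∘ sym , w , w≢v , w≢u , inj₂ p
  C12Adj-sym (u≢v , w , w≢u , w≢v , inj₂ p) = u≢v ∘ sym , w , w≢v , w≢u , inj₁ p

  C12Adj-via : ∀ {w z} → u ≢ v → w ≢ u → w ≢ v → z ≢ u →
               Arc o u w → Arc o v z → Arc o z w → C12Adj o u v
  C12Adj-via u≢v w≢u w≢v z≢u uw vz zw =
    u≢v , _ , w≢u , w≢v ,
    inj₁ ((u≢v , w≢v , inj₂ uw) , (u≢v ∘ sym , w≢u , inj₂ (inj₂ (_ , z≢u , vz , zw))))

  C12Adj⇒∃Arc≢ : C12Adj o u v → ∃[ z ] (z ≢ v × Arc o u z)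
  C12Adj⇒∃Arc≢ (_ , w , w≢u , _ , inj₁ ((_ , _ , inj₁ u≡w) , _))  = ⊥-elim (w≢u (sym u≡w))
  C12Adj⇒∃Arc≢ (_ , w , _ , w≢v , inj₁ ((_ , _ , inj₂ uw) , _))   = w , w≢v , uw
  C12Adj⇒∃Arc≢ (_ , w , w≢u , _ , inj₂ (_ , (_ , _ , inj₁ u≡w))) = ⊥-elim (w≢u (sym u≡w))
  C12Adj⇒∃Arc≢ (_ , w , _ , w≢v , inj₂ (_ , (_ , _ , inj₂ (inj₁ uw)))) = w , w≢v , uw
  C12Adj⇒∃Arc≢ (_ , _ , _ , _ , inj₂ (_ , (_ , _ , inj₂ (inj₂ (z , z≢v , uz , _))))) =
    z , z≢v , uz

module _ {m n : ℕ} (o : Orientation m n) where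

  2≤outdeg⇒C12Adj : (∀ x → 2 ≤ outdeg o x) → ∀ i j → C12Adj o (inj₁ i) (inj₂ j)
  2≤outdeg⇒C12Adj 2≤d i j
    with 2≤outdeg⇒∃Arc≢ o (inj₁ i) (2≤d (inj₁ i)) (inj₂ j)
       | 2≤outdeg⇒∃Arc≢ o (inj₂ j) (2≤d (inj₂ j)) (inj₁ i)
  ... | inj₂ j′ , j′≢j , ij′ | inj₁ i′ , i′≢i , ji′ with o i′ j′ in i′j′?
  ... | true  = C12Adj-via {w = inj₂ j′} {z = inj₁ i′}
                  (λ ()) (λ ()) j′≢j i′≢i ij′ ji′ i′j′?
  ... | false = C12Adj-sym (C12Adj-via {w = inj₁ i′} {z = inj₂ j′}
                  (λ ()) (λ ()) i′≢i j′≢j ji′ ij′ j′i′)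
    where
    j′i′ : Arc o (inj₂ j′) (inj₁ i′)
    j′i′ rewrite i′j′? = refl

  C12Adj⇒2≤outdeg : 1 ≤ m → 1 ≤ n → (∀ i j → C12Adj o (inj₁ i) (inj₂ j)) →
                    ∀ x → 2 ≤ outdeg o x
  C12Adj⇒2≤outdeg _ 1≤n adj (inj₁ i) with C12Adj⇒∃Arc≢ (adj i (fromℕ< 1≤n))
  ... | z , _ , iz = no-unique-out-neighbour⇒2≤outdeg o (inj₁ i) {z} iz another
    where
    another : ∀ {z} → Arc o (inj₁ i) z → ∃[ z′ ] (z′ ≢ z × Arc o (inj₁ i) z′)
    another {inj₂ j} _ = C12Adj⇒∃Arc≢ (adj i j)
  C12Adj⇒2≤outdeg 1≤m _ adj (inj₂ j) with C12Adj⇒∃Arc≢ (C12Adj-sym (adj (fromℕ< 1≤m) j))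
  ... | z , _ , jz = no-unique-out-neighbour⇒2≤outdeg o (inj₂ j) {z} jz another
    where
    another : ∀ {z} → Arc o (inj₂ j) z → ∃[ z′ ] (z′ ≢ z × Arc o (inj₂ j) z′)
    another {inj₁ i} _ = C12Adj⇒∃Arc≢ (C12Adj-sym (adj i j))

corollary2p6 : (m n : ℕ) → 1 ≤ m → 1 ≤ n → (o : Orientation m n) →
    ((∀ (x : Vtx m n) → 2 ≤ outdeg o x) ⇔
     (∀ (i : Fin m) (j : Fin n) → C12Adj o (inj₁ i) (inj₂ j)))
corollary2p6 m n 1≤m 1≤n o = mk⇔ (2≤outdeg⇒C12Adj o) (C12Adj⇒2≤outdeg o 1≤m 1≤n)
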